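{- Let $k$ and $n$ be positive integers with $1\le k\le n$, let $f(x)=2x-1$, and let $\vec{s}=(s_1,\dots,s_k)$ be a $k$-tuple of positive integers. If there is a prime $p$ with $\frac{n}{k+\frac12}<p\le\frac{n}{k}$ and $p>2k$, then $$v_p\big(H_{k,f}(\vec{s},n)\big)=-\sum_{i=1}^k s_i.$$
   Context: For a prime $p$, $v_p$ denotes the $p$-adic valuation (extended to nonzero rationals by $v_p(x/y)=v_p(x)-v_p(y)$). For integers $1\le k\le n$, a polynomial $f$ with integer coefficients such that $f(m)\ne0$ for all positive integers $m$, and a $k$-tuple $\vec{s}$ of positive integers, $$H_{k,f}(\vec{s},n)=\sum_{1\le i_1<\cdots<i_k\le n}\prod_{j=1}^k\frac{1}{f(i_j)^{s_j}}.$$ -}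

module Defs where

open import Data.Nat as ℕ using (ℕ; zero; suc; _^_; NonZero; ≢-nonZero)
open import Data.Nat.Properties using (+-suc)
open import Data.Nat.Divisibility using (_∣_)
open import Data.Integer as ℤ using (ℤ; +_; ∣_∣)
open import Data.Rational as ℚ using (ℚ; ↥_; ↧ₙ_)
open import Data.List using (List; []; _∷_; [_]; map; concatMap; upTo; foldr)
open import Data.Vec using (Vec; []; _∷_)
open import Data.Product using (Σ; _×_)
open import Relation.Nullary using (¬_)
open import Relation.Binary.PropositionalEquality using (_≡_)

f : ℕ → ℤ
f x = (+ 2) ℤ.* (+ x) ℤ.- (+ 1)

f-nonZero : ∀ i → NonZero ∣ f i ∣
f-nonZero zero = _
f-nonZero (suc j) rewrite +-suc j (j ℕ.+ 0) = _

-- The term 1 / f(i)^s as a rational.  For the indices i ≥ 1 used below,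
-- f(i) > 0, so f(i)^s = ∣ f(i) ∣ ^ s.
term : ℕ → ℕ → ℚ
term i s = (+ 1) ℚ./ (∣ f i ∣ ^ s)
  where instance
          nz : NonZero (∣ f i ∣ ^ s)
          nz = Data.Nat.Properties.m^n≢0 ∣ f i ∣ s {{f-nonZero i}}
            where import Data.Nat.Properties

-- All strictly increasing k-tuples (i₁ < ⋯ < i_k) with a < i₁ and i_k ≤ n.
incTuples : (k a n : ℕ) → List (Vec ℕ k)
incTuples zero    a n = [ [] ]
incTuples (suc k) a n =
  concatMap (λ i → map (i ∷_) (incTuples k i n))
            (map (λ t → suc a ℕ.+ t) (upTo (n ℕ.∸ a)))

prodTerms : ∀ {k} → Vec ℕ k → Vec ℕ k → ℚ
prodTerms []       []       = ℚ.1ℚ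
prodTerms (s ∷ ss) (i ∷ is) = term i s ℚ.* prodTerms ss is

-- H_{k,f}(s, n) = Σ_{1 ≤ i₁ < ⋯ < i_k ≤ n} ∏_j 1 / f(i_j)^{s_j},  f(x) = 2x - 1.
H : ∀ {k} → Vec ℕ k → ℕ → ℚ
H {k} s n = foldr ℚ._+_ ℚ.0ℚ (map (prodTerms s) (incTuples k 0 n))

-- p-adic valuation of a natural number: v_p(m) = e  iff  p^e ∣ m and p^(e+1) ∤ m.
-- (Never holds for m = 0.)
ValNat : ℕ → ℕ → ℕ → Set
ValNat p m e = (p ^ e ∣ m) × ¬ (p ^ suc e ∣ m)

-- p-adic valuation of a rational x = num/den (reduced form):
-- v_p(x) = v_p(num) - v_p(den).  Holding implies x ≠ 0.
Valℚ : ℕ → ℚ → ℤ → Set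
Valℚ p x z = Σ ℕ λ a → Σ ℕ λ b →
  ValNat p ∣ ↥ x ∣ a × ValNat p (↧ₙ x) b × z ≡ (+ a) ℤ.- (+ b)

{-# OPTIONS --safe #-}
-- Write p = 2h + 1.  The indices i ≤ n with p ∣ f(i) = 2i − 1 are exactly Q t = pt + h + 1 for
-- t < k, and f(Q t) = p(2t + 1) with p ∤ 2t + 1 because 2t + 1 < 2k < p.  So 1/f(i)^s is a p-adic
-- unit unless i is one of these k special indices, where its valuation is exactly −s.  The tuple
-- (Q 0, …, Q (k − 1)) thus contributes valuation −Σ sⱼ, and every other tuple has some non-special
-- entry iⱼ, so (as sⱼ ≥ 1) its valuation is larger.
module Submission where

open import Defs
open import Data.Nat using (ℕ; _+_; _*_; _≤_; _<_)
open import Data.Nat.Primality using (Prime)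
open import Data.Integer as ℤ using (+_)
open import Data.Vec using (Vec; lookup; sum)
open import Data.Fin using (Fin)

open import Data.Nat as ℕ using (zero; suc; _∸_; _^_; NonZero; z≤n; s≤s)
import Data.Nat.Properties as ℕ
open import Data.Nat.Divisibility
  using (_∣_; _∣?_; divides; 1∣_; _∣0; ∣1⇒≡1; ∣-trans; m∣m*n; n∣m*n; ∣m⇒∣m*n; ∣n⇒∣m*n;
         ∣m∣n⇒∣m+n; ∣m+n∣m⇒∣n; *-monoʳ-∣; *-cancelʳ-∣; ∣⇒≤)
open import Data.Nat.Primality using (euclidsLemma; ¬prime[1]; prime⇒nonZero; prime⇒irreducible)
import Data.Nat.Coprimality as Coprimality
open import Algebra.Properties.CommutativeSemigroup ℕ.*-commutativeSemigroup using (interchange)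
open import Data.Nat.Tactic.RingSolver using (solve-∀)
import Data.Integer.Properties as ℤ
open import Data.Rational as ℚ using (ℚ; mkℚ; ↥_; ↧ₙ_; 1/_)
open import Data.Rational.Literals using (fromℤ)
import Data.Rational.Properties as ℚ
import Data.Rational.Unnormalised as ℚᵘ
import Data.Rational.Unnormalised.Properties as ℚᵘ
open import Data.List using (List; []; _∷_; _++_; map; concatMap; foldr; upTo; applyUpTo)
open import Data.Vec using ([]; _∷_)
import Data.List.Properties as List
open import Data.Fin using (zero; suc)
open import Data.Product using (∃-syntax; _×_; _,_)
open import Data.Sum using (_⊎_; inj₁; inj₂; [_,_]′)
open import Data.Unit using (⊤; tt)
open import Data.Empty using (⊥-elim)
open import Data.Maybe using (nothing)
open import Function using (_∘_)
open import Relation.Nullary using (¬_; yes; no)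
open import Relation.Binary.PropositionalEquality
import Tactic.RingSolver.Core.AlmostCommutativeRing as ACR

fromℕ : ℕ → ℚ
fromℕ m = fromℤ (+ m)

fromℕ-+ : ∀ m n → fromℕ (m + n) ≡ fromℕ m ℚ.+ fromℕ n
fromℕ-+ m n = ℚ.toℚᵘ-injective
  (ℚᵘ.≃-trans (ℚᵘ.*≡* eq) (ℚᵘ.≃-sym (ℚ.toℚᵘ-homo-+ (fromℕ m) (fromℕ n))))
  where
  eq : + (m + n) ℤ.* + 1 ≡ (+ m ℤ.* + 1 ℤ.+ + n ℤ.* + 1) ℤ.* + 1
  eq rewrite ℤ.*-identityʳ (+ m) | ℤ.*-identityʳ (+ n) = cong (ℤ._* + 1) (ℤ.pos-+ m n)

fromℕ-* : ∀ m n → fromℕ (m * n) ≡ fromℕ m ℚ.* fromℕ n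
fromℕ-* m n = ℚ.toℚᵘ-injective
  (ℚᵘ.≃-trans (ℚᵘ.*≡* (cong (ℤ._* + 1) (ℤ.pos-* m n))) (ℚᵘ.≃-sym (ℚ.toℚᵘ-homo-* (fromℕ m) (fromℕ n))))

1/m*m≡1 : ∀ m .{{_ : NonZero m}} → ((+ 1) ℚ./ m) ℚ.* fromℕ m ≡ ℚ.1ℚ
1/m*m≡1 (suc m) = trans (cong (ℚ._* fromℕ (suc m)) (ℚ.↥p/↧p≡p (1/ fromℕ (suc m))))
                        (ℚ.*-inverseˡ (fromℕ (suc m)))

*-fromℕ≡fromℕ⇒cross : ∀ x m c → x ℚ.* fromℕ m ≡ fromℕ c → ℤ.∣ ↥ x ∣ * m ≡ c * ↧ₙ x
*-fromℕ≡fromℕ⇒cross x@record{} m c eq = begin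
  ℤ.∣ ↥ x ∣ * m                 ≡⟨ ℤ.abs-* (↥ x) (+ m) ⟨
  ℤ.∣ ↥ x ℤ.* + m ∣             ≡⟨ cong ℤ.∣_∣ cross ⟩
  ℤ.∣ + c ℤ.* ℚ.↧ x ∣           ≡⟨ ℤ.abs-* (+ c) (ℚ.↧ x) ⟩
  c * ↧ₙ x                      ∎
  where
  open ≡-Reasoning
  cross : ↥ x ℤ.* + m ≡ + c ℤ.* ℚ.↧ x
  cross = trans (sym (ℤ.*-identityʳ _)) (trans
    (ℚᵘ.drop-*≡* (ℚᵘ.≃-trans (ℚᵘ.≃-sym (ℚ.toℚᵘ-homo-* x (fromℕ m))) (ℚ.toℚᵘ-cong eq)))
    (cong (λ d → + c ℤ.* + d) (ℕ.*-identityʳ (↧ₙ x))))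

^-distribʳ-* : ∀ m n e → (m * n) ^ e ≡ m ^ e * n ^ e
^-distribʳ-* m n zero    = refl
^-distribʳ-* m n (suc e) = trans (cong (m * n *_) (^-distribʳ-* m n e)) (interchange m n (m ^ e) (n ^ e))

term*∣f∣^s≡1 : ∀ i s → term i s ℚ.* fromℕ (ℤ.∣ f i ∣ ^ s) ≡ ℚ.1ℚ
term*∣f∣^s≡1 i s = 1/m*m≡1 (ℤ.∣ f i ∣ ^ s) {{ℕ.m^n≢0 ℤ.∣ f i ∣ s {{f-nonZero i}}}}

module _ where
  open import Tactic.RingSolver.NonReflective (ACR.fromCommutativeRing ℚ.+-*-commutativeRing (λ _ → nothing))
  open ≡-Reasoning

  scaled-eq-+ : ∀ x y P D D′ {c c′} → x ℚ.* (P ℚ.* D) ≡ c → y ℚ.* (P ℚ.* D′) ≡ c′ →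
                (x ℚ.+ y) ℚ.* (P ℚ.* (D ℚ.* D′)) ≡ c ℚ.* D′ ℚ.+ c′ ℚ.* D
  scaled-eq-+ x y P D D′ {c} {c′} eq eq′ = begin
    (x ℚ.+ y) ℚ.* (P ℚ.* (D ℚ.* D′))
      ≡⟨ solve 5 (λ x y P D D′ → (x ⊕ y) ⊗ (P ⊗ (D ⊗ D′)) ⊜ (x ⊗ (P ⊗ D) ⊗ D′ ⊕ y ⊗ (P ⊗ D′) ⊗ D))
               refl x y P D D′ ⟩
    x ℚ.* (P ℚ.* D) ℚ.* D′ ℚ.+ y ℚ.* (P ℚ.* D′) ℚ.* D
      ≡⟨ cong₂ (λ u v → u ℚ.* D′ ℚ.+ v ℚ.* D) eq eq′ ⟩
    c ℚ.* D′ ℚ.+ c′ ℚ.* D ∎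

  scaled-eq-* : ∀ x y P P′ D D′ {c c′} → x ℚ.* (P ℚ.* D) ≡ c → y ℚ.* (P′ ℚ.* D′) ≡ c′ →
                (x ℚ.* y) ℚ.* ((P ℚ.* P′) ℚ.* (D ℚ.* D′)) ≡ c ℚ.* c′
  scaled-eq-* x y P P′ D D′ {c} {c′} eq eq′ = begin
    (x ℚ.* y) ℚ.* ((P ℚ.* P′) ℚ.* (D ℚ.* D′))
      ≡⟨ solve 6 (λ x y P P′ D D′ → (x ⊗ y) ⊗ ((P ⊗ P′) ⊗ (D ⊗ D′)) ⊜ (x ⊗ (P ⊗ D)) ⊗ (y ⊗ (P′ ⊗ D′)))
               refl x y P P′ D D′ ⟩
    (x ℚ.* (P ℚ.* D)) ℚ.* (y ℚ.* (P′ ℚ.* D′))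
      ≡⟨ cong₂ ℚ._*_ eq eq′ ⟩
    c ℚ.* c′ ∎

  scaled-eq-weaken : ∀ x P P′ D {c} → x ℚ.* (P ℚ.* D) ≡ c → x ℚ.* ((P ℚ.* P′) ℚ.* D) ≡ c ℚ.* P′
  scaled-eq-weaken x P P′ D {c} eq = begin
    x ℚ.* ((P ℚ.* P′) ℚ.* D)
      ≡⟨ solve 4 (λ x P P′ D → x ⊗ ((P ⊗ P′) ⊗ D) ⊜ (x ⊗ (P ⊗ D)) ⊗ P′) refl x P P′ D ⟩
    (x ℚ.* (P ℚ.* D)) ℚ.* P′
      ≡⟨ cong (ℚ._* P′) eq ⟩
    c ℚ.* P′ ∎

module Valuation (p : ℕ) (p-prime : Prime p) where

  instance
    p-nonZero : NonZero p
    p-nonZero = prime⇒nonZero p-prime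

  p∤1 : ¬ p ∣ 1
  p∤1 p∣1 = ¬prime[1] (subst Prime (∣1⇒≡1 p∣1) p-prime)

  p∤* : ∀ {m n} → ¬ p ∣ m → ¬ p ∣ n → ¬ p ∣ m * n
  p∤* p∤m p∤n p∣mn = [ p∤m , p∤n ]′ (euclidsLemma _ _ p-prime p∣mn)

  p∤^ : ∀ {m} e → ¬ p ∣ m → ¬ p ∣ m ^ e
  p∤^ zero    p∤m = p∤1
  p∤^ (suc e) p∤m = p∤* p∤m (p∤^ e p∤m)

  p^e∣m*n⇒p^e∣n : ∀ e {m n} → ¬ p ∣ m → p ^ e ∣ m * n → p ^ e ∣ n
  p^e∣m*n⇒p^e∣n zero    p∤m _ = 1∣ _
  p^e∣m*n⇒p^e∣n (suc e) {m} {n} p∤m p^[1+e]∣mn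
    with euclidsLemma m n p-prime (∣-trans (m∣m*n (p ^ e)) p^[1+e]∣mn)
  ... | inj₁ p∣m = ⊥-elim (p∤m p∣m)
  ... | inj₂ (divides q refl) =
    subst (p * p ^ e ∣_) (ℕ.*-comm p q) (*-monoʳ-∣ p (p^e∣m*n⇒p^e∣n e p∤m p^e∣mq))
    where
    p^e∣mq : p ^ e ∣ m * q
    p^e∣mq = *-cancelʳ-∣ p (subst₂ _∣_ (ℕ.*-comm p (p ^ e)) (sym (ℕ.*-assoc m q p)) p^[1+e]∣mn)

  -- Scaled P e x says p^e · x = c / d with p ∤ d and P c.  So Val≥, Val> and Val≡ below
  -- express v_p(x) ≥ −e, v_p(x) > −e and v_p(x) = −e.
  record Scaled (P : ℕ → Set) (e : ℕ) (x : ℚ) : Set where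
    constructor scaled
    field
      num den   : ℕ
      p∤den     : ¬ p ∣ den
      num-ok    : P num
      scaled-eq : x ℚ.* (fromℕ (p ^ e) ℚ.* fromℕ den) ≡ fromℕ num

  Val≥ Val> Val≡ : ℕ → ℚ → Set
  Val≥ = Scaled (λ _ → ⊤)
  Val> = Scaled (p ∣_)
  Val≡ = Scaled (λ c → ¬ p ∣ c)

  scaled-+ : ∀ {P P′ P″ : ℕ → Set} {e x y} →
             (∀ {c d c′ d′} → ¬ p ∣ d → ¬ p ∣ d′ → P c → P′ c′ → P″ (c * d′ + c′ * d)) →
             Scaled P e x → Scaled P′ e y → Scaled P″ e (x ℚ.+ y)
  scaled-+ {e = e} {x} {y} closed (scaled c d p∤d Pc eq) (scaled c′ d′ p∤d′ P′c′ eq′) =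
    scaled (c * d′ + c′ * d) (d * d′) (p∤* p∤d p∤d′) (closed p∤d p∤d′ Pc P′c′) (begin
      (x ℚ.+ y) ℚ.* (fromℕ (p ^ e) ℚ.* fromℕ (d * d′))
        ≡⟨ cong (λ z → (x ℚ.+ y) ℚ.* (fromℕ (p ^ e) ℚ.* z)) (fromℕ-* d d′) ⟩
      (x ℚ.+ y) ℚ.* (fromℕ (p ^ e) ℚ.* (fromℕ d ℚ.* fromℕ d′))
        ≡⟨ scaled-eq-+ x y (fromℕ (p ^ e)) (fromℕ d) (fromℕ d′) eq eq′ ⟩
      fromℕ c ℚ.* fromℕ d′ ℚ.+ fromℕ c′ ℚ.* fromℕ d
        ≡⟨ cong₂ ℚ._+_ (fromℕ-* c d′) (fromℕ-* c′ d) ⟨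
      fromℕ (c * d′) ℚ.+ fromℕ (c′ * d)
        ≡⟨ fromℕ-+ (c * d′) (c′ * d) ⟨
      fromℕ (c * d′ + c′ * d) ∎)
    where open ≡-Reasoning

  scaled-* : ∀ {P P′ P″ : ℕ → Set} {e e′ x y} →
             (∀ {c c′} → P c → P′ c′ → P″ (c * c′)) →
             Scaled P e x → Scaled P′ e′ y → Scaled P″ (e + e′) (x ℚ.* y)
  scaled-* {e = e} {e′} {x} {y} closed (scaled c d p∤d Pc eq) (scaled c′ d′ p∤d′ P′c′ eq′) =
    scaled (c * c′) (d * d′) (p∤* p∤d p∤d′) (closed Pc P′c′) (begin
      (x ℚ.* y) ℚ.* (fromℕ (p ^ (e + e′)) ℚ.* fromℕ (d * d′))
        ≡⟨ cong₂ (λ u v → (x ℚ.* y) ℚ.* (u ℚ.* v))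
                 (trans (cong fromℕ (ℕ.^-distribˡ-+-* p e e′)) (fromℕ-* (p ^ e) (p ^ e′))) (fromℕ-* d d′) ⟩
      (x ℚ.* y) ℚ.* ((fromℕ (p ^ e) ℚ.* fromℕ (p ^ e′)) ℚ.* (fromℕ d ℚ.* fromℕ d′))
        ≡⟨ scaled-eq-* x y (fromℕ (p ^ e)) (fromℕ (p ^ e′)) (fromℕ d) (fromℕ d′) eq eq′ ⟩
      fromℕ c ℚ.* fromℕ c′
        ≡⟨ fromℕ-* c c′ ⟨
      fromℕ (c * c′) ∎)
    where open ≡-Reasoning

  scaled-weaken : ∀ {P P′ : ℕ → Set} {e x} m →
                  (∀ {c} → P c → P′ (c * p ^ m)) → Scaled P e x → Scaled P′ (e + m) x
  scaled-weaken {e = e} {x} m closed (scaled c d p∤d Pc eq) =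
    scaled (c * p ^ m) d p∤d (closed Pc) (begin
      x ℚ.* (fromℕ (p ^ (e + m)) ℚ.* fromℕ d)
        ≡⟨ cong (λ u → x ℚ.* (u ℚ.* fromℕ d))
                (trans (cong fromℕ (ℕ.^-distribˡ-+-* p e m)) (fromℕ-* (p ^ e) (p ^ m))) ⟩
      x ℚ.* ((fromℕ (p ^ e) ℚ.* fromℕ (p ^ m)) ℚ.* fromℕ d)
        ≡⟨ scaled-eq-weaken x (fromℕ (p ^ e)) (fromℕ (p ^ m)) (fromℕ d) eq ⟩
      fromℕ c ℚ.* fromℕ (p ^ m)
        ≡⟨ fromℕ-* c (p ^ m) ⟨
      fromℕ (c * p ^ m) ∎)
    where open ≡-Reasoning

  Val≡⇒Val≥ : ∀ {e x} → Val≡ e x → Val≥ e x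
  Val≡⇒Val≥ (scaled c d p∤d _ eq) = scaled c d p∤d tt eq

  Val>⇒Val≥ : ∀ {e x} → Val> e x → Val≥ e x
  Val>⇒Val≥ (scaled c d p∤d _ eq) = scaled c d p∤d tt eq

  Val>-0 : ∀ {e} → Val> e ℚ.0ℚ
  Val>-0 {e} = scaled 0 1 p∤1 (p ∣0) (ℚ.*-zeroˡ (fromℕ (p ^ e) ℚ.* fromℕ 1))

  Val≡-1 : Val≡ 0 ℚ.1ℚ
  Val≡-1 = scaled 1 1 p∤1 p∤1 refl

  Val≥-+ : ∀ {e x y} → Val≥ e x → Val≥ e y → Val≥ e (x ℚ.+ y)
  Val≥-+ = scaled-+ λ _ _ _ _ → tt

  Val>-+ : ∀ {e x y} → Val> e x → Val> e y → Val> e (x ℚ.+ y)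
  Val>-+ = scaled-+ λ {_} {d} {_} {d′} _ _ p∣c p∣c′ → ∣m∣n⇒∣m+n (∣m⇒∣m*n d′ p∣c) (∣m⇒∣m*n d p∣c′)

  Val>-+-Val≡ : ∀ {e x y} → Val> e x → Val≡ e y → Val≡ e (x ℚ.+ y)
  Val>-+-Val≡ = scaled-+ λ {_} {d} {c′} {d′} p∤d _ p∣c p∤c′ p∣sum →
    p∤* p∤c′ p∤d (∣m+n∣m⇒∣n p∣sum (∣m⇒∣m*n d′ p∣c))

  Val≡-+-Val> : ∀ {e x y} → Val≡ e x → Val> e y → Val≡ e (x ℚ.+ y)
  Val≡-+-Val> {x = x} {y} vx vy = subst (Val≡ _) (ℚ.+-comm y x) (Val>-+-Val≡ vy vx)

  Val≥-* : ∀ {e e′ x y} → Val≥ e x → Val≥ e′ y → Val≥ (e + e′) (x ℚ.* y)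
  Val≥-* = scaled-* λ _ _ → tt

  Val≥-*-Val> : ∀ {e e′ x y} → Val≥ e x → Val> e′ y → Val> (e + e′) (x ℚ.* y)
  Val≥-*-Val> = scaled-* λ {c} _ p∣c′ → ∣n⇒∣m*n c p∣c′

  Val>-*-Val≥ : ∀ {e e′ x y} → Val> e x → Val≥ e′ y → Val> (e + e′) (x ℚ.* y)
  Val>-*-Val≥ = scaled-* λ {_} {c′} p∣c _ → ∣m⇒∣m*n c′ p∣c

  Val≡-* : ∀ {e e′ x y} → Val≡ e x → Val≡ e′ y → Val≡ (e + e′) (x ℚ.* y)
  Val≡-* = scaled-* p∤*

  Val≥-weaken : ∀ {e x} m → Val≥ e x → Val≥ (e + m) x
  Val≥-weaken m = scaled-weaken m λ _ → tt

  Val≥⇒Val> : ∀ {e x} m → Val≥ e x → Val> (e + suc m) x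
  Val≥⇒Val> m = scaled-weaken (suc m) λ {c} _ → ∣n⇒∣m*n c (m∣m*n (p ^ m))

  Val≡⇒valuation : ∀ {e x} → Val≡ e x → Valℚ p x (ℤ.- (+ e))
  Val≡⇒valuation {e} {x@(mkℚ _ _ coprime)} (scaled c d p∤d p∤c eq) =
    0 , e , (1∣ N , p∤N ∘ subst (_∣ N) (ℕ.*-identityʳ p)) , (p^e∣M , p^[1+e]∤M) , sym (ℤ.+-identityˡ _)
    where
    N = ℤ.∣ ↥ x ∣
    M = ↧ₙ x

    cross : N * (p ^ e * d) ≡ c * M
    cross = *-fromℕ≡fromℕ⇒cross x (p ^ e * d) c (trans (cong (x ℚ.*_) (fromℕ-* (p ^ e) d)) eq)

    p∤N : ¬ p ∣ N
    p∤N p∣N with euclidsLemma c M p-prime (subst (p ∣_) cross (∣m⇒∣m*n (p ^ e * d) p∣N))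
    ... | inj₁ p∣c = p∤c p∣c
    ... | inj₂ p∣M = ¬prime[1] (subst Prime (Coprimality.recompute coprime (p∣N , p∣M)) p-prime)

    p^e∣M : p ^ e ∣ M
    p^e∣M = p^e∣m*n⇒p^e∣n e p∤c (subst (p ^ e ∣_) cross (∣-trans (m∣m*n d) (n∣m*n N)))

    p^[1+e]∤M : ¬ p ^ suc e ∣ M
    p^[1+e]∤M p^[1+e]∣M = p∤* p∤N p∤d (*-cancelʳ-∣ (p ^ e) {{ℕ.m^n≢0 p e}}
      (subst (p * p ^ e ∣_) rearrange (∣n⇒∣m*n c p^[1+e]∣M)))
      where
      rearrange : c * M ≡ (N * d) * p ^ e
      rearrange = trans (sym cross) (trans (cong (N *_) (ℕ.*-comm (p ^ e) d)) (sym (ℕ.*-assoc N d (p ^ e))))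

  term-Val≡-unit : ∀ i s → ¬ p ∣ ℤ.∣ f i ∣ → Val≡ 0 (term i s)
  term-Val≡-unit i s p∤fi = scaled 1 (ℤ.∣ f i ∣ ^ s) (p∤^ s p∤fi) p∤1
    (trans (cong (term i s ℚ.*_) (ℚ.*-identityˡ _)) (term*∣f∣^s≡1 i s))

  term-Val≡-simple : ∀ i {w} s → ℤ.∣ f i ∣ ≡ p * w → ¬ p ∣ w → Val≡ s (term i s)
  term-Val≡-simple i {w} s ∣fi∣≡pw p∤w = scaled 1 (w ^ s) (p∤^ s p∤w) p∤1 (begin
    term i s ℚ.* (fromℕ (p ^ s) ℚ.* fromℕ (w ^ s))  ≡⟨ cong (term i s ℚ.*_) (fromℕ-* (p ^ s) (w ^ s)) ⟨
    term i s ℚ.* fromℕ (p ^ s * w ^ s)              ≡⟨ cong (λ m → term i s ℚ.* fromℕ m) p^s*w^s≡∣fi∣^s ⟩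
    term i s ℚ.* fromℕ (ℤ.∣ f i ∣ ^ s)              ≡⟨ term*∣f∣^s≡1 i s ⟩
    ℚ.1ℚ                                            ∎)
    where
    open ≡-Reasoning
    p^s*w^s≡∣fi∣^s : p ^ s * w ^ s ≡ ℤ.∣ f i ∣ ^ s
    p^s*w^s≡∣fi∣^s = trans (sym (^-distribʳ-* p w s)) (cong (_^ s) (sym ∣fi∣≡pw))

downward-induction : ∀ {ℓ} n {P : ℕ → Set ℓ} → (∀ {a} → n ≤ a → P a) → (∀ {a} → a < n → P (suc a) → P a) →
                     ∀ a → P a
downward-induction n {P} base step a = go (n ∸ a) a refl
  where
  go : ∀ d a → n ∸ a ≡ d → P a
  go zero    a n∸a≡0   = base (ℕ.m∸n≡0⇒m≤n n∸a≡0)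
  go (suc d) a n∸a≡1+d = step a<n (go d (suc a) n∸[1+a]≡d)
    where
    a<n : a < n
    a<n = ℕ.m∸n≢0⇒n<m λ n∸a≡0 → ℕ.0≢1+n (trans (sym n∸a≡0) n∸a≡1+d)
    n∸[1+a]≡d : n ∸ suc a ≡ d
    n∸[1+a]≡d = trans (sym (ℕ.pred[m∸n]≡m∸[1+n] n a)) (cong ℕ.pred n∸a≡1+d)

applyUpTo-cong : ∀ {a} {A : Set a} {g h : ℕ → A} → (∀ i → g i ≡ h i) → ∀ m → applyUpTo g m ≡ applyUpTo h m
applyUpTo-cong g≗h zero    = refl
applyUpTo-cong g≗h (suc m) = cong₂ _∷_ (g≗h 0) (applyUpTo-cong (g≗h ∘ suc) m)

upTo-shift : ∀ {n a} → a < n →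
             map (λ t → suc a + t) (upTo (n ∸ a)) ≡ suc a ∷ map (λ t → suc (suc a) + t) (upTo (n ∸ suc a))
upTo-shift {n} {a} a<n = begin
  map (λ t → suc a + t) (upTo (n ∸ a))
    ≡⟨ cong (λ m → map (λ t → suc a + t) (upTo m)) (ℕ.+-∸-assoc 1 a<n) ⟩
  map (λ t → suc a + t) (upTo (suc (n ∸ suc a)))
    ≡⟨ List.map-upTo (λ t → suc a + t) (suc (n ∸ suc a)) ⟩
  suc a + 0 ∷ applyUpTo (λ t → suc a + suc t) (n ∸ suc a)
    ≡⟨ cong₂ _∷_ (ℕ.+-identityʳ (suc a)) (applyUpTo-cong (ℕ.+-suc (suc a)) (n ∸ suc a)) ⟩
  suc a ∷ applyUpTo (λ t → suc (suc a) + t) (n ∸ suc a)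
    ≡⟨ cong (suc a ∷_) (List.map-upTo (λ t → suc (suc a) + t) (n ∸ suc a)) ⟨
  suc a ∷ map (λ t → suc (suc a) + t) (upTo (n ∸ suc a)) ∎
  where open ≡-Reasoning

Σℚ : List ℚ → ℚ
Σℚ = foldr ℚ._+_ ℚ.0ℚ

Σℚ-++ : ∀ xs ys → Σℚ (xs ++ ys) ≡ Σℚ xs ℚ.+ Σℚ ys
Σℚ-++ []       ys = sym (ℚ.+-identityˡ (Σℚ ys))
Σℚ-++ (x ∷ xs) ys = trans (cong (x ℚ.+_) (Σℚ-++ xs ys)) (sym (ℚ.+-assoc x (Σℚ xs) (Σℚ ys)))

Σℚ-prodTerms-∷ : ∀ {j} i s₁ (s : Vec ℕ j) is →
                 Σℚ (map (prodTerms (s₁ ∷ s)) (map (i ∷_) is)) ≡ term i s₁ ℚ.* Σℚ (map (prodTerms s) is)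
Σℚ-prodTerms-∷ i s₁ s []        = sym (ℚ.*-zeroʳ (term i s₁))
Σℚ-prodTerms-∷ i s₁ s (is ∷ iss) =
  trans (cong (term i s₁ ℚ.* prodTerms s is ℚ.+_) (Σℚ-prodTerms-∷ i s₁ s iss))
        (sym (ℚ.*-distribˡ-+ (term i s₁) (prodTerms s is) _))

H-above : ∀ {j} → ℕ → Vec ℕ j → ℕ → ℚ
H-above {j} n s a = Σℚ (map (prodTerms s) (incTuples j a n))

H-above-base : ∀ {j n a} s₁ (s : Vec ℕ j) → n ≤ a → H-above n (s₁ ∷ s) a ≡ ℚ.0ℚ
H-above-base s₁ s n≤a rewrite ℕ.m≤n⇒m∸n≡0 n≤a = refl

H-above-step : ∀ {j n a} s₁ (s : Vec ℕ j) → a < n →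
               H-above n (s₁ ∷ s) a ≡ term (suc a) s₁ ℚ.* H-above n s (suc a) ℚ.+ H-above n (s₁ ∷ s) (suc a)
H-above-step {j} {n} {a} s₁ s a<n = begin
  H-above n (s₁ ∷ s) a
    ≡⟨ cong (λ is → Σℚ (map (prodTerms (s₁ ∷ s)) (concatMap tuples is))) (upTo-shift a<n) ⟩
  Σℚ (map (prodTerms (s₁ ∷ s)) (tuples (suc a) ++ rest))
    ≡⟨ cong Σℚ (List.map-++ (prodTerms (s₁ ∷ s)) (tuples (suc a)) rest) ⟩
  Σℚ (map (prodTerms (s₁ ∷ s)) (tuples (suc a)) ++ map (prodTerms (s₁ ∷ s)) rest)
    ≡⟨ Σℚ-++ (map (prodTerms (s₁ ∷ s)) (tuples (suc a))) _ ⟩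
  Σℚ (map (prodTerms (s₁ ∷ s)) (tuples (suc a))) ℚ.+ H-above n (s₁ ∷ s) (suc a)
    ≡⟨ cong (ℚ._+ H-above n (s₁ ∷ s) (suc a)) (Σℚ-prodTerms-∷ (suc a) s₁ s (incTuples j (suc a) n)) ⟩
  term (suc a) s₁ ℚ.* H-above n s (suc a) ℚ.+ H-above n (s₁ ∷ s) (suc a) ∎
  where
  open ≡-Reasoning
  tuples : ℕ → List (Vec ℕ (suc j))
  tuples i = map (i ∷_) (incTuples j i n)
  rest : List (Vec ℕ (suc j))
  rest = concatMap tuples (map (λ t → suc (suc a) + t) (upTo (n ∸ suc a)))

Positive : ∀ {j} → Vec ℕ j → Set
Positive {j} s = ∀ (i : Fin j) → 1 ≤ lookup s i

record SpecialIndices (p n k : ℕ) : Set where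
  field
    index            : ℕ → ℕ
    index-strictMono : ∀ {t u} → t < u → index t < index u
    index≤n          : ∀ {t} → t < k → index t ≤ n
    n<index-k        : n < index k
    p∣f⇒index        : ∀ i → p ∣ ℤ.∣ f i ∣ → ∃[ t ] i ≡ index t
    f-index          : ∀ {t} → t < k → ∃[ w ] ℤ.∣ f (index t) ∣ ≡ p * w × ¬ p ∣ w

  index-mono : ∀ {t u} → t ≤ u → index t ≤ index u
  index-mono t≤u with ℕ.m≤n⇒m<n∨m≡n t≤u
  ... | inj₁ t<u  = ℕ.<⇒≤ (index-strictMono t<u)
  ... | inj₂ refl = ℕ.≤-refl

  index-cancel-< : ∀ {t u} → index t < index u → t < u
  index-cancel-< index-t<index-u = ℕ.≰⇒> λ u≤t → ℕ.<⇒≱ index-t<index-u (index-mono u≤t)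

  index≤n⇒<k : ∀ {t} → index t ≤ n → t < k
  index≤n⇒<k index-t≤n = ℕ.≰⇒> λ k≤t → ℕ.<⇒≱ (ℕ.<-≤-trans n<index-k (index-mono k≤t)) index-t≤n

module _ {p n k : ℕ} (p-prime : Prime p) (S : SpecialIndices p n k) where
  open Valuation p p-prime
  open SpecialIndices S

  index-0-positive : 0 < index 0
  index-0-positive = ℕ.n≢0⇒n>0 λ index-0≡0 →
    let (w , ∣f∣≡pw , _) = f-index (index≤n⇒<k (subst (_≤ n) (sym index-0≡0) z≤n))
    in p∤1 (divides w (trans (subst (λ i → ℤ.∣ f i ∣ ≡ p * w) index-0≡0 ∣f∣≡pw) (ℕ.*-comm p w)))

  term-Val≥ : ∀ i s → i ≤ n → Val≥ s (term i s)
  term-Val≥ i s i≤n with p ∣? ℤ.∣ f i ∣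
  ... | no p∤fi = Val≥-weaken s (Val≡⇒Val≥ (term-Val≡-unit i s p∤fi))
  ... | yes p∣fi with p∣f⇒index i p∣fi
  ...   | t , refl with f-index (index≤n⇒<k i≤n)
  ...     | w , ∣fi∣≡pw , p∤w = Val≡⇒Val≥ (term-Val≡-simple (index t) s ∣fi∣≡pw p∤w)

  term-Val>-unit : ∀ i {s} → 1 ≤ s → ¬ p ∣ ℤ.∣ f i ∣ → Val> s (term i s)
  term-Val>-unit i {suc m} _ p∤fi = Val≥⇒Val> m (Val≡⇒Val≥ (term-Val≡-unit i (suc m) p∤fi))

  H-above-Val≥ : ∀ {j} (s : Vec ℕ j) a → Val≥ (sum s) (H-above n s a)
  H-above-Val≥ []       a = Val≡⇒Val≥ Val≡-1
  H-above-Val≥ (s₁ ∷ s) = downward-induction n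
    (λ n≤a → subst (Val≥ _) (sym (H-above-base s₁ s n≤a)) (Val>⇒Val≥ Val>-0))
    (λ {a} a<n rest → subst (Val≥ _) (sym (H-above-step s₁ s a<n))
      (Val≥-+ (Val≥-* (term-Val≥ (suc a) s₁ a<n) (H-above-Val≥ s (suc a))) rest))

  -- The j = k − r positions left take indices above a.  If index r ≤ a, fewer than j special
  -- indices lie above a, so every tuple uses a non-special one.  If index r is the least special
  -- index above a, only the tuple (index r, …, index (k − 1)) reaches the minimal valuation.
  H-above-Val> : ∀ {j} (s : Vec ℕ j) → Positive s → ∀ r → r + j ≡ k → ∀ a → a ≤ n → index r ≤ a →
                 Val> (sum s) (H-above n s a)
  H-above-Val> []       _   r r+0≡k a a≤n index-r≤a =
    ⊥-elim (ℕ.<⇒≱ n<index-k (ℕ.≤-trans (subst (λ t → index t ≤ a) r≡k index-r≤a) a≤n))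
    where
    r≡k : r ≡ k
    r≡k = trans (sym (ℕ.+-identityʳ r)) r+0≡k
  H-above-Val> {suc j} (s₁ ∷ s) pos r r+1+j≡k a _ = downward-induction n
    (λ n≤a _ → subst (Val> _) (sym (H-above-base s₁ s n≤a)) Val>-0)
    step a
    where
    Claim : ℕ → Set
    Claim a = index r ≤ a → Val> (sum (s₁ ∷ s)) (H-above n (s₁ ∷ s) a)

    leading : ∀ {a} → a < n → index r ≤ a → Val> (s₁ + sum s) (term (suc a) s₁ ℚ.* H-above n s (suc a))
    leading {a} a<n index-r≤a with p ∣? ℤ.∣ f (suc a) ∣
    ... | no p∤f = Val>-*-Val≥ (term-Val>-unit (suc a) (pos zero) p∤f) (H-above-Val≥ s (suc a))
    ... | yes p∣f with p∣f⇒index (suc a) p∣f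
    ...   | t , 1+a≡index-t =
      Val≥-*-Val> (term-Val≥ (suc a) s₁ a<n)
                  (H-above-Val> s (pos ∘ suc) (suc r) (trans (sym (ℕ.+-suc r j)) r+1+j≡k) (suc a) a<n index-1+r≤1+a)
      where
      index-1+r≤1+a : index (suc r) ≤ suc a
      index-1+r≤1+a = subst (index (suc r) ≤_) (sym 1+a≡index-t)
        (index-mono (index-cancel-< (subst (index r <_) 1+a≡index-t (s≤s index-r≤a))))

    step : ∀ {a} → a < n → Claim (suc a) → Claim a
    step a<n rest index-r≤a = subst (Val> _) (sym (H-above-step s₁ s a<n))
      (Val>-+ (leading a<n index-r≤a) (rest (ℕ.m≤n⇒m≤1+n index-r≤a)))

  H-above-Val≡ : ∀ {j} (s : Vec ℕ j) → Positive s → ∀ r → r + j ≡ k →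
                 ∀ a → a < index r → (∀ t → a < index t → r ≤ t) → Val≡ (sum s) (H-above n s a)
  H-above-Val≡ []       _   _ _ _ _ _ = Val≡-1
  H-above-Val≡ {suc j} (s₁ ∷ s) pos r r+1+j≡k = downward-induction n
    (λ n≤a a<index-r _ → ⊥-elim (ℕ.<⇒≱ (ℕ.<-≤-trans a<index-r (index≤n r<k)) n≤a))
    step
    where
    r<k : r < k
    r<k = subst (r <_) r+1+j≡k (ℕ.m<m+n r (s≤s z≤n))

    Claim : ℕ → Set
    Claim a = a < index r → (∀ t → a < index t → r ≤ t) → Val≡ (sum (s₁ ∷ s)) (H-above n (s₁ ∷ s) a)

    step : ∀ {a} → a < n → Claim (suc a) → Claim a
    step {a} a<n rest a<index-r fresh with suc a ℕ.≟ index r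
    ... | yes 1+a≡index-r = subst (Val≡ _) (sym (H-above-step s₁ s a<n))
      (Val≡-+-Val> (Val≡-* special (H-above-Val≡ s (pos ∘ suc) (suc r) (trans (sym (ℕ.+-suc r j)) r+1+j≡k)
                                                  (suc a) 1+a<index-1+r fresh′))
                   (H-above-Val> (s₁ ∷ s) pos r r+1+j≡k (suc a) a<n (ℕ.≤-reflexive (sym 1+a≡index-r))))
      where
      special : Val≡ s₁ (term (suc a) s₁)
      special with f-index r<k
      ... | w , ∣f∣≡pw , p∤w =
        term-Val≡-simple (suc a) s₁ (subst (λ i → ℤ.∣ f i ∣ ≡ p * w) (sym 1+a≡index-r) ∣f∣≡pw) p∤w
      1+a<index-1+r : suc a < index (suc r)
      1+a<index-1+r = subst (_< index (suc r)) (sym 1+a≡index-r) (index-strictMono (ℕ.n<1+n r))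
      fresh′ : ∀ t → suc a < index t → suc r ≤ t
      fresh′ t 1+a<index-t = index-cancel-< (subst (_< index t) 1+a≡index-r 1+a<index-t)
    ... | no 1+a≢index-r = subst (Val≡ _) (sym (H-above-step s₁ s a<n))
      (Val>-+-Val≡ (Val>-*-Val≥ (term-Val>-unit (suc a) (pos zero) p∤f) (H-above-Val≥ s (suc a)))
                   (rest 1+a<index-r λ t 1+a<index-t → fresh t (ℕ.<-trans (ℕ.n<1+n a) 1+a<index-t)))
      where
      1+a<index-r : suc a < index r
      1+a<index-r = ℕ.≤∧≢⇒< a<index-r 1+a≢index-r
      p∤f : ¬ p ∣ ℤ.∣ f (suc a) ∣
      p∤f p∣f with p∣f⇒index (suc a) p∣f
      ... | t , 1+a≡index-t = ℕ.<⇒≱ 1+a<index-r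
        (subst (index r ≤_) (sym 1+a≡index-t) (index-mono (fresh t (subst (a <_) 1+a≡index-t (ℕ.n<1+n a)))))

  valuation-H : (s : Vec ℕ k) → Positive s → Valℚ p (H s n) (ℤ.- (+ sum s))
  valuation-H s pos = Val≡⇒valuation (H-above-Val≡ s pos 0 refl 0 index-0-positive λ _ _ → z≤n)

even⊎odd : ∀ n → ∃[ h ] (n ≡ h + h ⊎ n ≡ suc (h + h))
even⊎odd zero    = 0 , inj₁ refl
even⊎odd (suc n) with even⊎odd n
... | h , inj₁ n≡2h   = h , inj₂ (cong suc n≡2h)
... | h , inj₂ n≡1+2h = suc h , inj₁ (trans (cong suc n≡1+2h) (cong suc (sym (ℕ.+-suc h h))))

odd≢even : ∀ m n → suc (m + m) ≢ n + n
odd≢even m       zero    ()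
odd≢even zero    (suc n) 1≡2+2n with trans (ℕ.suc-injective 1≡2+2n) (ℕ.+-suc n n)
... | ()
odd≢even (suc m) (suc n) 3+2m≡2+2n = odd≢even m n
  (ℕ.suc-injective (trans (cong suc (sym (ℕ.+-suc m m))) (trans (ℕ.suc-injective 3+2m≡2+2n) (ℕ.+-suc n n))))

half-injective : ∀ m n → m + m ≡ n + n → m ≡ n
half-injective m n 2m≡2n = ℕ.*-cancelˡ-≡ m n 2
  (trans (cong (_+_ m) (ℕ.+-identityʳ m)) (trans 2m≡2n (cong (_+_ n) (sym (ℕ.+-identityʳ n)))))

even-prime≡2 : ∀ h → Prime (h + h) → h + h ≡ 2
even-prime≡2 h h+h-prime = [ (λ ()) , sym ]′ (prime⇒irreducible h+h-prime 2∣h+h)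
  where
  2∣h+h : 2 ∣ h + h
  2∣h+h = divides h (trans (cong (_+_ h) (sym (ℕ.+-identityʳ h))) (ℕ.*-comm 2 h))

∣f[1+m]∣≡1+2m : ∀ m → ℤ.∣ f (suc m) ∣ ≡ suc (m + m)
∣f[1+m]∣≡1+2m m = trans (cong (_+_ m) (ℕ.+-identityʳ (suc m))) (ℕ.+-suc m m)

module OddPrime (h : ℕ) where

  p : ℕ
  p = suc (h + h)

  Q : ℕ → ℕ
  Q t = suc (p * t + h)

  2*Q≡[2t+1]p+1 : ∀ t → 2 * Q t ≡ (2 * t + 1) * p + 1
  2*Q≡[2t+1]p+1 = identity h
    where
    identity : ∀ h t → 2 * suc (suc (h + h) * t + h) ≡ (2 * t + 1) * suc (h + h) + 1
    identity = solve-∀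

  1+2[pt+h]≡p[1+2t] : ∀ t → suc ((p * t + h) + (p * t + h)) ≡ p * suc (t + t)
  1+2[pt+h]≡p[1+2t] = identity h
    where
    identity : ∀ h t → suc ((suc (h + h) * t + h) + (suc (h + h) * t + h)) ≡ suc (h + h) * suc (t + t)
    identity = solve-∀

  p∣f⇒Q : Prime p → ∀ i → p ∣ ℤ.∣ f i ∣ → ∃[ t ] i ≡ Q t
  p∣f⇒Q p-prime zero    p∣1 = ⊥-elim (Valuation.p∤1 p p-prime p∣1)
  p∣f⇒Q p-prime (suc m) (divides w ∣f∣≡wp) with even⊎odd w
  ... | v , inj₁ refl = ⊥-elim (odd≢even m (v * p)
    (trans (trans (sym (∣f[1+m]∣≡1+2m m)) ∣f∣≡wp) (ℕ.*-distribʳ-+ p v v)))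
  ... | v , inj₂ refl = v , cong suc (half-injective m (p * v + h) (ℕ.suc-injective (begin
    suc (m + m)          ≡⟨ ∣f[1+m]∣≡1+2m m ⟨
    ℤ.∣ f (suc m) ∣      ≡⟨ ∣f∣≡wp ⟩
    suc (v + v) * p      ≡⟨ ℕ.*-comm (suc (v + v)) p ⟩
    p * suc (v + v)      ≡⟨ 1+2[pt+h]≡p[1+2t] v ⟨
    suc ((p * v + h) + (p * v + h)) ∎)))
    where open ≡-Reasoning

  module _ {n k : ℕ} (2n<[2k+1]p : 2 * n < (2 * k + 1) * p) (kp≤n : k * p ≤ n) (2k<p : 2 * k < p) where
    open ℕ.≤-Reasoning

    Q≤n : ∀ {t} → t < k → Q t ≤ n
    Q≤n {t} t<k = ℕ.*-cancelˡ-≤ 2 (begin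
      2 * Q t              ≡⟨ 2*Q≡[2t+1]p+1 t ⟩
      (2 * t + 1) * p + 1  ≤⟨ ℕ.+-monoʳ-≤ ((2 * t + 1) * p) (s≤s z≤n) ⟩
      (2 * t + 1) * p + p  ≡⟨ identity t p ⟩
      2 * suc t * p        ≤⟨ ℕ.*-monoˡ-≤ p (ℕ.*-monoʳ-≤ 2 t<k) ⟩
      2 * k * p            ≡⟨ ℕ.*-assoc 2 k p ⟩
      2 * (k * p)          ≤⟨ ℕ.*-monoʳ-≤ 2 kp≤n ⟩
      2 * n                ∎)
      where
      identity : ∀ t p → (2 * t + 1) * p + p ≡ 2 * suc t * p
      identity = solve-∀

    n<Q-k : n < Q k
    n<Q-k = ℕ.*-cancelˡ-< 2 n (Q k) (begin-strict
      2 * n                <⟨ 2n<[2k+1]p ⟩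
      (2 * k + 1) * p      ≤⟨ ℕ.m≤m+n _ 1 ⟩
      (2 * k + 1) * p + 1  ≡⟨ 2*Q≡[2t+1]p+1 k ⟨
      2 * Q k              ∎)

    p∤2t+1 : ∀ {t} → t < k → ¬ p ∣ suc (t + t)
    p∤2t+1 {t} t<k p∣2t+1 = ℕ.<-irrefl refl (begin-strict
      p                    ≤⟨ ∣⇒≤ p∣2t+1 ⟩
      suc (t + t)          <⟨ s≤s (ℕ.≤-reflexive (sym (ℕ.+-suc t t))) ⟩
      suc t + suc t        ≤⟨ ℕ.+-mono-≤ t<k t<k ⟩
      k + k                ≡⟨ cong (_+_ k) (ℕ.+-identityʳ k) ⟨
      2 * k                <⟨ 2k<p ⟩
      p                    ∎)

    specialIndices : Prime p → SpecialIndices p n k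
    specialIndices p-prime = record
      { index            = Q
      ; index-strictMono = λ t<u → s≤s (ℕ.+-monoˡ-< h (ℕ.*-monoʳ-< p t<u))
      ; index≤n          = Q≤n
      ; n<index-k        = n<Q-k
      ; p∣f⇒index        = p∣f⇒Q p-prime
      ; f-index          = λ {t} t<k → suc (t + t) , trans (∣f[1+m]∣≡1+2m (p * t + h)) (1+2[pt+h]≡p[1+2t] t) , p∤2t+1 t<k
      }

lemma2p7 : (k n : ℕ) → 1 ≤ k → k ≤ n →
           (s : Vec ℕ k) → (∀ (j : Fin k) → 1 ≤ lookup s j) →
           (p : ℕ) → Prime p →
           2 * n < (2 * k + 1) * p → k * p ≤ n → 2 * k < p →
           Valℚ p (H s n) (ℤ.- (+ sum s))
lemma2p7 k n 1≤k _ s pos p p-prime 2n<[2k+1]p kp≤n 2k<p with even⊎odd p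
... | h , inj₁ refl =
  ⊥-elim (ℕ.<⇒≱ (subst (2 * k <_) (even-prime≡2 h p-prime) 2k<p) (ℕ.*-monoʳ-≤ 2 1≤k))
... | h , inj₂ refl =
  valuation-H p-prime (OddPrime.specialIndices h 2n<[2k+1]p kp≤n 2k<p p-prime) s pos
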